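{- For all $c,d,\tau\ge 0$ there exists $c'\ge 0$ with the following property. Let $G$ be a graph with $\chi^1(G)\le\tau$ and $\chi(G)>c'$. Then there is a spire $(P,A,B)$ in $G$ of height $d$ dominating a set $C\subseteq V(G)$ with $\chi(G[C])>c$.
   Context: Graphs are finite and simple; $\chi^1(G)=\max_v\chi(G[N^1[v]])$, where $N^1[v]$ is $v$ together with its neighbours. A set $A$ covers a set $B$ (disjoint from $A$) if every vertex of $B$ has a neighbour in $A$. A spire is a triple $(P,A,B)$ where $P$ is an induced path and $A,B\subseteq V(G)$ with: $G[A]$ connected; $A\cap B=\emptyset$; $A$ covers $B$; $V(P)\cap B=\emptyset$; some end $z$ of $P$ satisfies $V(P)\cap A=\{z\}$; and no vertex of $V(P)\setminus\{z\}$ has a neighbour in $(A\cup B)\setminus\{z\}$. Its height is the length (number of edges) of $P$. The spire dominates $C$ if $C$ is disjoint from $A\cup B\cup V(P)$, there are no edges between $A\cup V(P)$ and $C$, and $B$ covers $C$. -}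

module Defs where

open import Data.Nat using (ℕ; suc)
open import Data.Fin using (Fin; toℕ; fromℕ; zero)
open import Data.Fin.Subset using (Subset; _∈_; _∉_)
open import Data.Bool using (Bool; true; false)
open import Data.Product using (Σ; ∃; ∃-syntax; _×_; _,_)
open import Data.Sum using (_⊎_)
open import Relation.Binary.PropositionalEquality using (_≡_; _≢_)
open import Relation.Nullary using (¬_)
open import Function.Definitions using (Injective)

record Graph (n : ℕ) : Set where
  field
    edge   : Fin n → Fin n → Bool
    sym    : ∀ u v → edge u v ≡ edge v u
    irrefl : ∀ v → edge v v ≡ false

module _ {n : ℕ} (G : Graph n) where

  Adj : Fin n → Fin n → Set
  Adj u v = Graph.edge G u v ≡ true

  Colourable : Subset n → ℕ → Set
  Colourable S k = Σ (Fin n → Fin k) λ f →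
    ∀ u v → u ∈ S → v ∈ S → Adj u v → f u ≢ f v

  ClosedNbhd : Fin n → Fin n → Set
  ClosedNbhd v u = u ≡ v ⊎ Adj v u

  Chi1≤ : ℕ → Set
  Chi1≤ τ = ∀ v → Σ (Fin n → Fin τ) λ f →
    ∀ u w → ClosedNbhd v u → ClosedNbhd v w → Adj u w → f u ≢ f w

  Chi≤ : ℕ → Set
  Chi≤ k = Σ (Fin n → Fin k) λ f → ∀ u v → Adj u v → f u ≢ f v

  data ReachIn (S : Subset n) : Fin n → Fin n → Set where
    here : ∀ {u} → u ∈ S → ReachIn S u u
    step : ∀ {u v w} → u ∈ S → Adj u v → ReachIn S v w → ReachIn S u w

  -- G[S] connected (nonemptiness is not needed below: z ∈ A is required)
  ConnectedIn : Subset n → Set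
  ConnectedIn S = ∀ u v → u ∈ S → v ∈ S → ReachIn S u v

  Covers : Subset n → Subset n → Set
  Covers A B = ∀ b → b ∈ B → ∃[ a ] (a ∈ A × Adj a b)

  IsInducedPath : (d : ℕ) → (Fin (suc d) → Fin n) → Set
  IsInducedPath d p =
    Injective _≡_ _≡_ p
    × (∀ i j → toℕ j ≡ suc (toℕ i) → Adj (p i) (p j))
    × (∀ i j → Adj (p i) (p j) → toℕ j ≡ suc (toℕ i) ⊎ toℕ i ≡ suc (toℕ j))

  record Spire (d : ℕ) : Set where
    field
      path  : Fin (suc d) → Fin n
      A     : Subset n
      B     : Subset n
      z     : Fin n
      isPath  : IsInducedPath d path
      zEnd    : z ≡ path zero ⊎ z ≡ path (fromℕ d)
      connA   : ConnectedIn A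
      disjAB  : ∀ v → v ∈ A → v ∉ B
      coverAB : Covers A B
      disjPB  : ∀ i → path i ∉ B
      zInA    : z ∈ A
      PA⊆z    : ∀ i → path i ∈ A → path i ≡ z
      noEdges : ∀ i w → path i ≢ z → (w ∈ A ⊎ w ∈ B) → w ≢ z → ¬ Adj (path i) w

  Dominates : ∀ {d} → Spire d → Subset n → Set
  Dominates s C =
    (∀ v → v ∈ C → v ∉ Spire.A s × v ∉ Spire.B s × (∀ i → Spire.path s i ≢ v))
    × (∀ u v → v ∈ C → (u ∈ Spire.A s ⊎ ∃[ i ] (Spire.path s i ≡ u)) → ¬ Adj u v)
    × Covers (Spire.B s) C

module Submission where

-- The spire is built by growing an induced path one vertex at a time while
-- keeping a "reservoir": a set D of large chromatic number that avoids the
-- path, is seen only by its current first vertex z, and is connected to z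
-- (a Tower).  To add a vertex we remove from D the neighbours of z, which
-- costs at most τ colours since χ¹(G) ≤ τ, pass to a component Y of the rest
-- of chromatic number still large, and prepend to the path the last vertex of
-- a walk from z into Y before it enters Y; Y becomes the new reservoir.
-- After d steps we take breadth-first layers L₀ = {z}, L₁, L₂, … of D ∪ {z}.
-- Two colour palettes used on alternate layers colour D ∪ {z}, and L₀, L₁ are
-- cheap to colour, so some layer L_{j+2} has chromatic number > c; then
-- (path, L₀ ∪ … ∪ L_j, L_{j+1}) is a spire of height d dominating L_{j+2}.

open import Defs
open import Data.Bool using (true)
import Data.Bool as Bool
open import Data.Empty using (⊥-elim)
open import Data.Fin using (Fin; zero; suc; toℕ; join; splitAt; inject≤; finToFun; funToFin)
open import Data.Fin.Properties using (any?; all?; ¬∀⟶∃¬; finToFun-funToFin; splitAt-join; inject≤-injective)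
import Data.Fin.Properties as Fin
open import Data.Fin.Subset using (Subset; _∈_; _∉_; _⊆_; _∩_; _∪_; ⁅_⁆; ∣_∣; ⊤)
open import Data.Fin.Subset.Properties
  using (_∈?_; ∈⊤; x∈⁅x⁆; x∈⁅y⁆⇒x≡y; x∈p∩q⁺; x∈p∩q⁻; x∈p∪q⁺; x∈p∪q⁻; p⊆p∪q; ⊆-antisym; p⊂q⇒∣p∣<∣q∣; ∣p∣≤n)
open import Data.Nat using (ℕ; zero; suc; _+_; _*_; _≤_; _<_; _⊔_; z≤n; s≤s; _≤?_; _≟_; pred; parity)
open import Data.Nat.GeneralisedArithmetic using (fold)
open import Data.Nat.Properties
  using (≤-refl; ≤-trans; ≤-antisym; ≤-total; ≤-pred; ≤-<-trans; ≤⇒≯; ≤-reflexive; <⇒≤; m≤n⇒m≤1+n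
        ; m≤n⇒m<n∨m≡n; n≤0⇒n≡0; 0≢1+n; m≤m⊔n; m≤n⊔m; +-assoc; +-identityʳ; anyUpTo?)
open import Data.Parity.Base using (Parity; 0ℙ; 1ℙ)
open import Data.Parity.Properties using (p≢p⁻¹; suc-homo-⁻¹)
import Data.Parity.Properties as ℙ
open import Data.Product using (Σ; ∃; ∃₂; ∃-syntax; _×_; _,_; proj₁; proj₂)
open import Data.Sum using (_⊎_; inj₁; inj₂; swap)
open import Data.Sum.Properties using (inj₁-injective; inj₂-injective)
open import Data.Vec using (tabulate)
open import Data.Vec.Functional using (_∷_)
open import Data.Vec.Properties using (lookup∘tabulate; []=⇒lookup; lookup⇒[]=; ≡-dec)
open import Function using (_∘_)
open import Level using (0ℓ)
open import Relation.Binary.PropositionalEquality using (_≡_; _≢_; refl; sym; trans; cong; subst)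
open import Relation.Nullary using (¬_; Dec; yes; no; does)
open import Relation.Nullary.Decidable using (dec-true; decidable-stable; _×-dec_; _→-dec_; ¬?)
open import Relation.Unary using (Pred; Decidable)

module _ {n : ℕ} {P : Pred (Fin n) 0ℓ} (P? : Decidable P) where

  select : Subset n
  select = tabulate (λ x → does (P? x))

  ∈-select : ∀ {x} → P x → x ∈ select
  ∈-select {x} px = lookup⇒[]= x select (trans (lookup∘tabulate _ x) (dec-true (P? x) px))

  select-∈ : ∀ {x} → x ∈ select → P x
  select-∈ {x} x∈ with P? x | trans (sym (lookup∘tabulate (λ y → does (P? y)) x)) ([]=⇒lookup x∈)
  ... | yes px | _ = px
  ... | no _   | ()

module _ {n : ℕ} (F : Subset n → Subset n) (inflationary : ∀ X → X ⊆ F X) where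

  strict-growth : ∀ X → F X ≢ X → ∣ X ∣ < ∣ F X ∣
  strict-growth X changed = p⊂q⇒∣p∣<∣q∣ (inflationary X , new-element)
    where
    F⊈X : ¬ (∀ x → x ∈ F X → x ∈ X)
    F⊈X F⊆X = changed (⊆-antisym (λ {x} → F⊆X x) (inflationary X))

    new-element : ∃ λ x → x ∈ F X × x ∉ X
    new-element with ¬∀⟶∃¬ n _ (λ x → x ∈? F X →-dec x ∈? X) F⊈X
    ... | x , escapes with x ∈? F X
    ...   | yes x∈FX = x , x∈FX , λ x∈X → escapes (λ _ → x∈X)
    ...   | no x∉FX  = ⊥-elim (escapes (λ x∈FX → ⊥-elim (x∉FX x∈FX)))

  stopped-or-large : ∀ X₀ i → F (fold X₀ F i) ≡ fold X₀ F i ⊎ i ≤ ∣ fold X₀ F i ∣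
  stopped-or-large X₀ zero = inj₂ z≤n
  stopped-or-large X₀ (suc i) with ≡-dec Bool._≟_ (F (fold X₀ F i)) (fold X₀ F i) | stopped-or-large X₀ i
  ... | yes fixed  | _              = inj₁ (cong F fixed)
  ... | no changed | inj₁ fixed     = ⊥-elim (changed fixed)
  ... | no changed | inj₂ i≤size    = inj₂ (≤-<-trans i≤size (strict-growth _ changed))

  -- Hence, as no subset of Fin n has more than n elements, iterating F from
  -- any starting set reaches a fixed point after n steps.
  stationary : ∀ X₀ → F (fold X₀ F n) ≡ fold X₀ F n
  stationary X₀ with ≡-dec Bool._≟_ (F (fold X₀ F n)) (fold X₀ F n) | stopped-or-large X₀ n
  ... | yes fixed  | _           = fixed
  ... | no changed | inj₁ fixed  = ⊥-elim (changed fixed)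
  ... | no changed | inj₂ n≤size =
    ⊥-elim (≤⇒≯ (∣p∣≤n (F (fold X₀ F n))) (≤-<-trans n≤size (strict-growth _ changed)))

module _ {P : ℕ → Set} (P? : ∀ i → Dec (P i)) where

  -- least k: the least i ≤ k satisfying P, or k itself if there is none.
  least : ℕ → ℕ
  least zero = zero
  least (suc k) with P? (least k)
  ... | yes _ = least k
  ... | no _  = suc k

  least-≤ : ∀ k → least k ≤ k
  least-≤ zero = z≤n
  least-≤ (suc k) with P? (least k)
  ... | yes _ = m≤n⇒m≤1+n (least-≤ k)
  ... | no _  = ≤-refl

  least-spec : ∀ k {j} → P j → j ≤ k → P (least k) × least k ≤ j
  least-spec zero pj z≤n = pj , z≤n
  least-spec (suc k) pj j≤1+k with P? (least k) | m≤n⇒m<n∨m≡n j≤1+k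
  ... | yes pl | inj₁ (s≤s j≤k) = pl , proj₂ (least-spec k pj j≤k)
  ... | yes pl | inj₂ refl      = pl , m≤n⇒m≤1+n (least-≤ k)
  ... | no ¬pl | inj₁ (s≤s j≤k) = ⊥-elim (¬pl (proj₁ (least-spec k pj j≤k)))
  ... | no _   | inj₂ refl      = pj , ≤-refl

parity-flip : ∀ k → parity (suc k) ≢ parity k
parity-flip k e = p≢p⁻¹ (parity (suc k)) (trans e (sym (suc-homo-⁻¹ k)))

join-injective : ∀ a b {x y : Fin a ⊎ Fin b} → join a b x ≡ join a b y → x ≡ y
join-injective a b {x} {y} e =
  trans (sym (splitAt-join a b x)) (trans (cong (splitAt a) e) (splitAt-join a b y))

module _ {n : ℕ} (G : Graph n) where

  adj-sym : ∀ {u v} → Adj G u v → Adj G v u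
  adj-sym {u} {v} a = trans (Graph.sym G v u) a

  adj-irrefl : ∀ {v} → ¬ Adj G v v
  adj-irrefl {v} a with trans (sym a) (Graph.irrefl G v)
  ... | ()

  adj? : ∀ u v → Dec (Adj G u v)
  adj? u v = Graph.edge G u v Bool.≟ true

  nbr : Fin n → Subset n
  nbr z = select (adj? z)

  touches? : ∀ X v → Dec (∃ λ u → u ∈ X × Adj G u v)
  touches? X v = any? (λ u → u ∈? X ×-dec adj? u v)

  nbrs : Subset n → Subset n
  nbrs X = select (touches? X)

  ∈-nbrs : ∀ {X u v} → u ∈ X → Adj G u v → v ∈ nbrs X
  ∈-nbrs {X} u∈ a = ∈-select (touches? X) (_ , u∈ , a)

  nbrs-∈ : ∀ {X v} → v ∈ nbrs X → ∃ λ u → u ∈ X × Adj G u v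
  nbrs-∈ {X} = select-∈ (touches? X)

  Proper : ∀ {k} → Subset n → (Fin n → Fin k) → Set
  Proper S f = ∀ u v → u ∈ S → v ∈ S → Adj G u v → f u ≢ f v

  proper? : ∀ {k} S (f : Fin n → Fin k) → Dec (Proper S f)
  proper? S f = all? λ u → all? λ v →
    u ∈? S →-dec (v ∈? S →-dec (adj? u v →-dec ¬? (f u Fin.≟ f v)))

  -- Colourability is decidable: there are finitely many colourings, enumerated by Fin (k ^ n).
  colourable? : ∀ S k → Dec (Colourable G S k)
  colourable? S k with any? (λ i → proper? S (finToFun i))
  ... | yes (i , ok) = yes (finToFun i , ok)
  ... | no none = no λ (f , ok) → none (funToFin f , λ u v u∈ v∈ a e →
          ok u v u∈ v∈ a (trans (sym (finToFun-funToFin f u)) (trans e (finToFun-funToFin f v))))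

  colourable-⊆ : ∀ {S T k} → T ⊆ S → Colourable G S k → Colourable G T k
  colourable-⊆ T⊆S (f , ok) = f , λ u v u∈ v∈ → ok u v (T⊆S u∈) (T⊆S v∈)

  colourable-≤ : ∀ {S k l} → k ≤ l → Colourable G S k → Colourable G S l
  colourable-≤ k≤l (f , ok) =
    (λ v → inject≤ (f v) k≤l) , λ u v u∈ v∈ a e → ok u v u∈ v∈ a (inject≤-injective k≤l k≤l _ _ e)

  colourable-∪ : ∀ {S X Y a b} → S ⊆ X ∪ Y → Colourable G X a → Colourable G Y b →
                 Colourable G S (a + b)
  colourable-∪ {S} {X} {Y} {a} {b} S⊆X∪Y (f , f-ok) (g , g-ok) = h , h-ok
    where
    side : ∀ v → Dec (v ∈ X) → Fin a ⊎ Fin b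
    side v (yes _) = inj₁ (f v)
    side v (no _)  = inj₂ (g v)

    h : Fin n → Fin (a + b)
    h v = join a b (side v (v ∈? X))

    in-Y : ∀ {v} → v ∈ S → v ∉ X → v ∈ Y
    in-Y v∈S v∉X with x∈p∪q⁻ X Y (S⊆X∪Y v∈S)
    ... | inj₁ v∈X = ⊥-elim (v∉X v∈X)
    ... | inj₂ v∈Y = v∈Y

    h-ok : Proper S h
    h-ok u v u∈ v∈ uv e
      with u ∈? X | v ∈? X | join-injective a b {side u (u ∈? X)} {side v (v ∈? X)} e
    ... | yes u∈X | yes v∈X | same = f-ok u v u∈X v∈X uv (inj₁-injective same)
    ... | no u∉X  | no v∉X  | same = g-ok u v (in-Y u∈ u∉X) (in-Y v∈ v∉X) uv (inj₂-injective same)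
    ... | yes _   | no _    | ()
    ... | no _    | yes _   | ()

-- A set with at most one vertex needs one colour; an empty set any positive
-- number (a colouring is a total function, so at least one colour must exist).
  subsingleton-colourable : ∀ {S} → (∀ {u v} → u ∈ S → v ∈ S → u ≡ v) → Colourable G S 1
  subsingleton-colourable same =
    (λ _ → zero) , λ u v u∈ v∈ a _ → adj-irrefl (subst (λ w → Adj G w v) (same u∈ v∈) a)

  empty-colourable : ∀ {S k} → (∀ v → v ∉ S) → Colourable G S (suc k)
  empty-colourable empty = (λ _ → zero) , λ u _ u∈ _ _ _ → empty u u∈

  nbr-colourable : ∀ {τ} → Chi1≤ G τ → ∀ z → Colourable G (nbr z) τ
  nbr-colourable χ¹≤τ z with χ¹≤τ z
  ... | f , ok = f , λ u v u∈ v∈ → ok u v (inj₂ (select-∈ (adj? z) u∈)) (inj₂ (select-∈ (adj? z) v∈))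

  chromatic-bound : ∀ {k} → Colourable G ⊤ k → Chi≤ G k
  chromatic-bound (f , ok) = f , λ u v → ok u v ∈⊤ ∈⊤

  reach-source : ∀ {S u v} → ReachIn G S u v → u ∈ S
  reach-source (here u∈)     = u∈
  reach-source (step u∈ _ _) = u∈

  reach-target : ∀ {S u v} → ReachIn G S u v → v ∈ S
  reach-target (here v∈)    = v∈
  reach-target (step _ _ w) = reach-target w

  reach-++ : ∀ {S u v w} → ReachIn G S u v → ReachIn G S v w → ReachIn G S u w
  reach-++ (here _)       w' = w'
  reach-++ (step u∈ a w)  w' = step u∈ a (reach-++ w w')

  reach-reverse : ∀ {S u v} → ReachIn G S u v → ReachIn G S v u
  reach-reverse (here u∈)     = here u∈
  reach-reverse (step u∈ a w) = reach-++ (reach-reverse w) (step (reach-source w) (adj-sym a) (here u∈))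

  reach-⊆ : ∀ {S S' u v} → S ⊆ S' → ReachIn G S u v → ReachIn G S' u v
  reach-⊆ S⊆S' (here u∈)     = here (S⊆S' u∈)
  reach-⊆ S⊆S' (step u∈ a w) = step (S⊆S' u∈) a (reach-⊆ S⊆S' w)

  exit : ∀ {S Y a b} → ReachIn G S a b → a ∉ Y → b ∈ Y →
         ∃₂ λ x y → x ∈ S × x ∉ Y × y ∈ Y × Adj G x y
  exit (here _) a∉Y a∈Y = ⊥-elim (a∉Y a∈Y)
  exit {Y = Y} (step {v = v} a∈S a~v w) a∉Y b∈Y with v ∈? Y
  ... | yes v∈Y = _ , v , a∈S , a∉Y , v∈Y , a~v
  ... | no v∉Y  = exit w v∉Y b∈Y

  expand : Subset n → Subset n → Subset n
  expand S X = X ∪ (S ∩ nbrs X)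

  expand-inflationary : ∀ S X → X ⊆ expand S X
  expand-inflationary S X x∈ = x∈p∪q⁺ (inj₁ x∈)

  -- Ball S r i: the vertices joined to r by a walk in G[S] with at most i edges.
  Ball : Subset n → Fin n → ℕ → Subset n
  Ball S r = fold (S ∩ ⁅ r ⁆) (expand S)

  -- The component of r in G[S]: balls stop growing after n steps.
  Comp : Subset n → Fin n → Subset n
  Comp S r = Ball S r n

  ball-reach : ∀ {S r} i {v} → v ∈ Ball S r i → ReachIn G S r v
  ball-reach {S} {r} zero v∈ with x∈p∩q⁻ S ⁅ r ⁆ v∈
  ... | v∈S , v∈⁅r⁆ with x∈⁅y⁆⇒x≡y r v∈⁅r⁆
  ...   | refl = here v∈S
  ball-reach {S} {r} (suc i) v∈ with x∈p∪q⁻ (Ball S r i) (S ∩ nbrs (Ball S r i)) v∈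
  ... | inj₁ old = ball-reach i old
  ... | inj₂ new with x∈p∩q⁻ S _ new
  ...   | v∈S , v∈nbrs with nbrs-∈ v∈nbrs
  ...     | u , u∈ , u~v = reach-++ (ball-reach i u∈) (step (reach-target (ball-reach i u∈)) u~v (here v∈S))

  root∈Ball : ∀ {S r} → r ∈ S → ∀ i → r ∈ Ball S r i
  root∈Ball {r = r} r∈S zero    = x∈p∩q⁺ (r∈S , x∈⁅x⁆ r)
  root∈Ball         r∈S (suc i) = x∈p∪q⁺ (inj₁ (root∈Ball r∈S i))

  comp-⊆ : ∀ {S r} → Comp S r ⊆ S
  comp-⊆ v∈ = reach-target (ball-reach n v∈)

  -- A component is closed under adjacency in S, because the balls are stationary.
  comp-closed : ∀ {S r u v} → u ∈ Comp S r → v ∈ S → Adj G u v → v ∈ Comp S r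
  comp-closed {S} {r} {v = v} u∈ v∈S u~v =
    subst (v ∈_) (stationary (expand S) (expand-inflationary S) (S ∩ ⁅ r ⁆))
      (x∈p∪q⁺ (inj₂ (x∈p∩q⁺ (v∈S , ∈-nbrs u∈ u~v))))

  reach-in-comp : ∀ {S r u v} → u ∈ Comp S r → ReachIn G S u v → ReachIn G (Comp S r) u v
  reach-in-comp u∈ (here _)      = here u∈
  reach-in-comp u∈ (step _ a w)  = step u∈ a (reach-in-comp (comp-closed u∈ (reach-source w) a) w)

  reach-comp : ∀ {S r v} → ReachIn G S r v → v ∈ Comp S r
  reach-comp w = reach-target (reach-in-comp (root∈Ball (reach-source w) n) w)

  comp-rooted : ∀ {S r v} → v ∈ Comp S r → ReachIn G (Comp S r) r v
  comp-rooted v∈ = reach-in-comp (root∈Ball (reach-source (ball-reach n v∈)) n) (ball-reach n v∈)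

  comp-≡ : ∀ {S u v} → u ∈ S → v ∈ S → Adj G u v → Comp S u ≡ Comp S v
  comp-≡ {S} u∈ v∈ u~v = ⊆-antisym (neighbour u~v v∈) (neighbour (adj-sym u~v) u∈)
    where
    neighbour : ∀ {x y} → Adj G x y → y ∈ S → Comp S x ⊆ Comp S y
    neighbour x~y y∈ w∈ = reach-comp (step y∈ (adj-sym x~y) (ball-reach n w∈))

  -- The colouring
  -- used at v is the one found by the decision procedure for the set Comp S v,
  -- so adjacent vertices (which have equal components) use the same function.
  colourable-by-components : ∀ {S k} → (∀ r → r ∈ S → Colourable G (Comp S r) (suc k)) →
                             Colourable G S (suc k)
  colourable-by-components {S} {k} comp-col = paint , paint-ok
    where
    colouring : ∀ {X} → Dec (Colourable G X (suc k)) → Fin n → Fin (suc k)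
    colouring (yes (f , _)) = f
    colouring (no _)        = λ _ → zero

    colouring-proper : ∀ {X} (d : Dec (Colourable G X (suc k))) → Colourable G X (suc k) →
                       Proper X (colouring d)
    colouring-proper (yes (_ , ok)) _ = ok
    colouring-proper (no ¬col) col    = ⊥-elim (¬col col)

    paint : Fin n → Fin (suc k)
    paint v = colouring (colourable? (Comp S v) (suc k)) v

    paint-ok : Proper S paint
    paint-ok u v u∈ v∈ u~v e =
      colouring-proper (colourable? (Comp S v) (suc k)) (comp-col v v∈) u v
        (comp-closed (root∈Ball v∈ n) u∈ (adj-sym u~v)) (root∈Ball v∈ n) u~v
        (trans (cong (λ X → colouring (colourable? X (suc k)) u) (sym (comp-≡ u∈ v∈ u~v))) e)

-- Consequently a set that is not (k+1)-colourable has a component that is not;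
-- decidability of colourability makes the choice of that component effective.
  bad-component : ∀ {S k} → ¬ Colourable G S (suc k) →
                  ∃[ r ] (r ∈ S × ¬ Colourable G (Comp S r) (suc k))
  bad-component {S} {k} ¬col with any? (λ r → r ∈? S ×-dec ¬? (colourable? (Comp S r) (suc k)))
  ... | yes found = found
  ... | no none   = ⊥-elim (¬col (colourable-by-components λ r r∈ →
                      decidable-stable (colourable? _ _) (λ ¬c → none (r , r∈ , ¬c))))

  trivial-path : ∀ r → IsInducedPath G 0 (λ _ → r)
  trivial-path r =
    (λ { {zero} {zero} _ → refl }) , (λ { zero zero () }) , λ { zero zero a → ⊥-elim (adj-irrefl a) }

  prepend-induced : ∀ {k p y} → IsInducedPath G k p → (∀ i → y ≢ p i) → Adj G y (p zero) →
                    (∀ i → ¬ Adj G y (p (suc i))) → IsInducedPath G (suc k) (y ∷ p)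
  prepend-induced {p = p} {y = y} (injective , consecutive , only-consecutive) new y~p₀ y≁tail =
    injective′ , consecutive′ , only-consecutive′
    where
    injective′ : ∀ {i j} → (y ∷ p) i ≡ (y ∷ p) j → i ≡ j
    injective′ {zero}  {zero}  _ = refl
    injective′ {zero}  {suc j} e = ⊥-elim (new j e)
    injective′ {suc i} {zero}  e = ⊥-elim (new i (sym e))
    injective′ {suc i} {suc j} e = cong suc (injective e)

    consecutive′ : ∀ i j → toℕ j ≡ suc (toℕ i) → Adj G ((y ∷ p) i) ((y ∷ p) j)
    consecutive′ zero    (suc zero)    _ = y~p₀
    consecutive′ zero    (suc (suc _)) ()
    consecutive′ (suc i) (suc j)       e = consecutive i j (cong pred e)

    only-consecutive′ : ∀ i j → Adj G ((y ∷ p) i) ((y ∷ p) j) →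
                        toℕ j ≡ suc (toℕ i) ⊎ toℕ i ≡ suc (toℕ j)
    only-consecutive′ zero          zero          a = ⊥-elim (adj-irrefl a)
    only-consecutive′ zero          (suc zero)    _ = inj₁ refl
    only-consecutive′ zero          (suc (suc j)) a = ⊥-elim (y≁tail j a)
    only-consecutive′ (suc zero)    zero          _ = inj₂ refl
    only-consecutive′ (suc (suc i)) zero          a = ⊥-elim (y≁tail i (adj-sym a))
    only-consecutive′ (suc i)       (suc j)       a with only-consecutive i j a
    ... | inj₁ e = inj₁ (cong suc e)
    ... | inj₂ e = inj₂ (cong suc e)

  module Layers (T : Subset n) (z : Fin n) (z∈T : z ∈ T) (spans : T ⊆ Comp T z) where

    dist : Fin n → ℕ
    dist v = least (λ i → v ∈? Ball T z i) n

    dist-≤-n : ∀ v → dist v ≤ n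
    dist-≤-n v = least-≤ (λ i → v ∈? Ball T z i) n

    dist-≤ : ∀ {v} j → v ∈ Ball T z j → dist v ≤ j
    dist-≤ {v} j v∈ with ≤-total j n
    ... | inj₁ j≤n = proj₂ (least-spec (λ i → v ∈? Ball T z i) n v∈ j≤n)
    ... | inj₂ n≤j = ≤-trans (dist-≤-n v) n≤j

    ball-dist : ∀ {v} → v ∈ T → v ∈ Ball T z (dist v)
    ball-dist {v} v∈ = proj₁ (least-spec (λ i → v ∈? Ball T z i) n (spans v∈) ≤-refl)

    dist-root : dist z ≡ 0
    dist-root = n≤0⇒n≡0 (dist-≤ 0 (x∈p∩q⁺ (z∈T , x∈⁅x⁆ z)))

    dist≡0 : ∀ {v} → v ∈ T → dist v ≡ 0 → v ≡ z
    dist≡0 v∈ e =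
      x∈⁅y⁆⇒x≡y z (proj₂ (x∈p∩q⁻ T ⁅ z ⁆ (subst (λ i → _ ∈ Ball T z i) e (ball-dist v∈))))

    dist-suc-≢ : ∀ {v i} → dist v ≡ suc i → v ≢ z
    dist-suc-≢ e refl = 0≢1+n (trans (sym dist-root) e)

    dist-adj : ∀ {u v} → u ∈ T → v ∈ T → Adj G u v → dist v ≤ suc (dist u)
    dist-adj u∈ v∈ u~v =
      dist-≤ (suc _) (x∈p∪q⁺ (inj₂ (x∈p∩q⁺ (v∈ , ∈-nbrs (ball-dist u∈) u~v))))

    dist-parent : ∀ {v i} → v ∈ T → dist v ≡ suc i → ∃ λ u → u ∈ T × dist u ≡ i × Adj G u v
    dist-parent {v} {i} v∈ e with x∈p∪q⁻ (Ball T z i) _ (subst (λ j → v ∈ Ball T z j) e (ball-dist v∈))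
    ... | inj₁ near = ⊥-elim (≤⇒≯ (dist-≤ i near) (subst (i <_) (sym e) ≤-refl))
    ... | inj₂ new with nbrs-∈ (proj₂ (x∈p∩q⁻ T _ new))
    ...   | u , u∈ball , u~v = u , u∈T , ≤-antisym (dist-≤ i u∈ball) i≤dist-u , u~v
      where
      u∈T : u ∈ T
      u∈T = reach-target (ball-reach i u∈ball)

      i≤dist-u : i ≤ dist u
      i≤dist-u = ≤-pred (subst (_≤ suc (dist u)) e (dist-adj u∈T v∈ u~v))

    -- Adjacent vertices whose distances have the same parity are at equal distance
    -- (distances along an edge differ by at most one).
    same-parity-upward : ∀ {u v} → u ∈ T → v ∈ T → Adj G u v →
                         parity (dist u) ≡ parity (dist v) → dist u ≤ dist v → dist u ≡ dist v
    same-parity-upward {u} u∈ v∈ u~v par du≤dv with m≤n⇒m<n∨m≡n du≤dv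
    ... | inj₂ du≡dv = du≡dv
    ... | inj₁ du<dv = ⊥-elim (parity-flip (dist u)
            (trans (cong parity (≤-antisym du<dv (dist-adj u∈ v∈ u~v))) (sym par)))

    same-parity-same-dist : ∀ {u v} → u ∈ T → v ∈ T → Adj G u v →
                            parity (dist u) ≡ parity (dist v) → dist u ≡ dist v
    same-parity-same-dist {u} {v} u∈ v∈ u~v par with ≤-total (dist u) (dist v)
    ... | inj₁ du≤dv = same-parity-upward u∈ v∈ u~v par du≤dv
    ... | inj₂ dv≤du = sym (same-parity-upward v∈ u∈ (adj-sym u~v) (sym par) dv≤du)

    Layer : ℕ → Subset n
    Layer i = select (λ v → v ∈? T ×-dec dist v ≟ i)

    layer-∈ : ∀ {i v} → v ∈ Layer i → v ∈ T × dist v ≡ i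
    layer-∈ {i} = select-∈ (λ v → v ∈? T ×-dec dist v ≟ i)

    ∈-layer : ∀ {i v} → v ∈ T → dist v ≡ i → v ∈ Layer i
    ∈-layer {i} v∈ e = ∈-select (λ w → w ∈? T ×-dec dist w ≟ i) (v∈ , e)

    Within : ℕ → Subset n
    Within j = select (λ v → v ∈? T ×-dec dist v ≤? j)

    within-∈ : ∀ {j v} → v ∈ Within j → v ∈ T × dist v ≤ j
    within-∈ {j} = select-∈ (λ v → v ∈? T ×-dec dist v ≤? j)

    ∈-within : ∀ {j v} → v ∈ T → dist v ≤ j → v ∈ Within j
    ∈-within {j} v∈ le = ∈-select (λ v → v ∈? T ×-dec dist v ≤? j) (v∈ , le)

    -- Colour the layers of even and of odd distance with two separate palettes.
    colour-by-layers : ∀ {m} → (∀ i → Colourable G (Layer i) m) → Colourable G T (m + m)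
    colour-by-layers {m} layer-col = colourable-∪ by-parity (class-colourable 0ℙ) (class-colourable 1ℙ)
      where
      class? : ∀ p v → Dec (v ∈ T × parity (dist v) ≡ p)
      class? p v = v ∈? T ×-dec parity (dist v) ℙ.≟ p

      Class : Parity → Subset n
      Class p = select (class? p)

      by-parity : T ⊆ Class 0ℙ ∪ Class 1ℙ
      by-parity {v} v∈ with parity (dist v) in e
      ... | 0ℙ = x∈p∪q⁺ (inj₁ (∈-select (class? 0ℙ) (v∈ , e)))
      ... | 1ℙ = x∈p∪q⁺ (inj₂ (∈-select (class? 1ℙ) (v∈ , e)))

      -- within a class, adjacent vertices lie in the same layer
      class-colourable : ∀ p → Colourable G (Class p) m
      class-colourable p = (λ v → proj₁ (layer-col (dist v)) v) , ok
        where
        ok : Proper (Class p) (λ v → proj₁ (layer-col (dist v)) v)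
        ok u v u∈ v∈ u~v e with select-∈ (class? p) u∈ | select-∈ (class? p) v∈
        ... | u∈T , pu | v∈T , pv with same-parity-same-dist u∈T v∈T u~v (trans pu (sym pv))
        ...   | du≡dv = proj₂ (layer-col (dist u)) u v (∈-layer u∈T refl) (∈-layer v∈T (sym du≡dv)) u~v
          (subst (λ i → proj₁ (layer-col (dist u)) u ≡ proj₁ (layer-col i) v) (sym du≡dv) e)

    layer-0 : ∀ {u v} → u ∈ Layer 0 → v ∈ Layer 0 → u ≡ v
    layer-0 u∈ v∈ = trans (dist≡0 (proj₁ (layer-∈ u∈)) (proj₂ (layer-∈ u∈)))
                          (sym (dist≡0 (proj₁ (layer-∈ v∈)) (proj₂ (layer-∈ v∈))))

    layer-1⊆nbr : Layer 1 ⊆ nbr z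
    layer-1⊆nbr v∈ with dist-parent (proj₁ (layer-∈ v∈)) (proj₂ (layer-∈ v∈))
    ... | u , u∈ , du≡0 , u~v with dist≡0 u∈ du≡0
    ...   | refl = ∈-select (adj? z) u~v

    -- Given χ(G[N(z)]) ≤ τ, all layers are (1 + c ⊔ τ)-colourable once those at
    -- distance ≥ 2 are c-colourable (layers beyond n are empty).
    layers-colourable : ∀ {c τ} → Colourable G (nbr z) τ →
                        (∀ i → 2 ≤ i → i ≤ n → Colourable G (Layer i) c) →
                        ∀ i → Colourable G (Layer i) (suc (c ⊔ τ))
    layers-colourable _ _ 0 = colourable-≤ (s≤s z≤n) (subsingleton-colourable layer-0)
    layers-colourable {c} {τ} nbr-col _ 1 =
      colourable-≤ (m≤n⇒m≤1+n (m≤n⊔m c τ)) (colourable-⊆ layer-1⊆nbr nbr-col)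
    layers-colourable {c} {τ} _ far-col (suc (suc j)) with suc (suc j) ≤? n
    ... | yes i≤n = colourable-≤ (m≤n⇒m≤1+n (m≤m⊔n c τ)) (far-col _ (s≤s (s≤s z≤n)) i≤n)
    ... | no i≰n  = empty-colourable λ v v∈ → i≰n (subst (_≤ n) (proj₂ (layer-∈ v∈)) (dist-≤-n v))

    bad-layer : ∀ c {τ} → Colourable G (nbr z) τ → ¬ Colourable G T (suc (c ⊔ τ) + suc (c ⊔ τ)) →
                ∃[ j ] ¬ Colourable G (Layer (2 + j)) c
    bad-layer c nbr-col χ> with anyUpTo? (λ i → 2 ≤? i ×-dec ¬? (colourable? (Layer i) c)) (suc n)
    ... | yes (suc (suc j) , _ , _ , ¬col) = j , ¬col
    ... | yes (1 , _ , s≤s () , _)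
    ... | yes (0 , _ , () , _)
    ... | no none = ⊥-elim (χ> (colour-by-layers (layers-colourable nbr-col λ i 2≤i i≤n →
            decidable-stable (colourable? (Layer i) c) λ ¬col → none (i , s≤s i≤n , 2≤i , ¬col))))

    root∈within : ∀ j → z ∈ Within j
    root∈within j = ∈-within z∈T (subst (_≤ j) (sym dist-root) z≤n)

    descend : ∀ j k {v} → v ∈ T → dist v ≡ k → k ≤ j → ReachIn G (Within j) v z
    descend j zero v∈ dv≡0 _ with dist≡0 v∈ dv≡0
    ... | refl = here (root∈within j)
    descend j (suc k) v∈ dv≡ k<j with dist-parent v∈ dv≡
    ... | u , u∈ , du≡k , u~v =
      step (∈-within v∈ (subst (_≤ j) (sym dv≡) k<j)) (adj-sym u~v) (descend j k u∈ du≡k (<⇒≤ k<j))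

    within-connected : ∀ j → ConnectedIn G (Within j)
    within-connected j u v u∈ v∈ = reach-++ (down u∈) (reach-reverse (down v∈))
      where
      down : ∀ {w} → w ∈ Within j → ReachIn G (Within j) w z
      down w∈ = descend j _ (proj₁ (within-∈ w∈)) refl (proj₂ (within-∈ w∈))

    within-∉-layer : ∀ {j v} → v ∈ Within j → v ∉ Layer (suc j)
    within-∉-layer v∈W v∈L = ≤⇒≯ (proj₂ (within-∈ v∈W)) (≤-reflexive (sym (proj₂ (layer-∈ v∈L))))

    layer-covers : ∀ i → Covers G (Layer i) (Layer (suc i))
    layer-covers i v v∈ with dist-parent (proj₁ (layer-∈ v∈)) (proj₂ (layer-∈ v∈))
    ... | u , u∈ , du≡i , u~v = u , ∈-layer u∈ du≡i , u~v

    within-covers : ∀ j → Covers G (Within j) (Layer (suc j))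
    within-covers j v v∈ with layer-covers j v v∈
    ... | u , u∈ , u~v = u , ∈-within (proj₁ (layer-∈ u∈)) (≤-reflexive (proj₂ (layer-∈ u∈))) , u~v

    within-anticomplete : ∀ {j u v} → u ∈ Within j → v ∈ Layer (2 + j) → ¬ Adj G u v
    within-anticomplete u∈ v∈ u~v with within-∈ u∈ | layer-∈ v∈
    ... | u∈T , du≤j | v∈T , dv≡ =
      ≤⇒≯ (≤-trans (dist-adj u∈T v∈T u~v) (s≤s du≤j)) (≤-reflexive (sym dv≡))

    far-layer : ∀ {j v} → v ∈ Layer (2 + j) → v ∉ Within j × v ∉ Layer (suc j)
    far-layer v∈ =
      (λ v∈W → ≤⇒≯ (proj₂ (within-∈ v∈W)) (≤-trans (m≤n⇒m≤1+n ≤-refl) (≤-reflexive (sym dv≡))))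
      , λ v∈L → ≤⇒≯ (≤-reflexive (proj₂ (layer-∈ v∈L))) (≤-reflexive (sym dv≡))
      where
      dv≡ = proj₂ (layer-∈ v∈)

    layer-spire : ∀ {d} (p : Fin (suc d) → Fin n) → IsInducedPath G d p → p zero ≡ z →
                  (∀ i → p (suc i) ∉ T) → (∀ i {v} → v ∈ T → v ≢ z → ¬ Adj G (p (suc i)) v) →
                  ∀ j → Σ (Spire G d) λ s → Dominates G s (Layer (2 + j))
    layer-spire {d} p induced p₀≡z tail-outside tail-blind j =
      spire , separated , anticomplete , layer-covers (suc j)
      where
      spire : Spire G d
      spire = record
        { path = p ; A = Within j ; B = Layer (suc j) ; z = z ; isPath = induced
        ; zEnd = inj₁ (sym p₀≡z) ; connA = within-connected j ; disjAB = λ _ → within-∉-layer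
        ; coverAB = within-covers j ; disjPB = off-B ; zInA = root∈within j
        ; PA⊆z = A-on-path ; noEdges = no-edges }
        where
        off-B : ∀ i → p i ∉ Layer (suc j)
        off-B zero    p₀∈ = dist-suc-≢ (proj₂ (layer-∈ p₀∈)) p₀≡z
        off-B (suc i) p∈  = tail-outside i (proj₁ (layer-∈ p∈))

        A-on-path : ∀ i → p i ∈ Within j → p i ≡ z
        A-on-path zero    _  = p₀≡z
        A-on-path (suc i) p∈ = ⊥-elim (tail-outside i (proj₁ (within-∈ p∈)))

        no-edges : ∀ i w → p i ≢ z → (w ∈ Within j ⊎ w ∈ Layer (suc j)) → w ≢ z → ¬ Adj G (p i) w
        no-edges zero    _ p₀≢z _            _   = ⊥-elim (p₀≢z p₀≡z)
        no-edges (suc i) _ _    (inj₁ w∈A) w≢z = tail-blind i (proj₁ (within-∈ w∈A)) w≢z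
        no-edges (suc i) _ _    (inj₂ w∈B) w≢z = tail-blind i (proj₁ (layer-∈ w∈B)) w≢z

      separated : ∀ v → v ∈ Layer (2 + j) → v ∉ Within j × v ∉ Layer (suc j) × (∀ i → p i ≢ v)
      separated v v∈ = proj₁ (far-layer v∈) , proj₂ (far-layer v∈) , off-path
        where
        off-path : ∀ i → p i ≢ v
        off-path zero    e = dist-suc-≢ (proj₂ (layer-∈ v∈)) (trans (sym e) p₀≡z)
        off-path (suc i) e = tail-outside i (subst (_∈ T) (sym e) (proj₁ (layer-∈ v∈)))

      anticomplete : ∀ u v → v ∈ Layer (2 + j) → (u ∈ Within j ⊎ ∃[ i ] (p i ≡ u)) → ¬ Adj G u v
      anticomplete u v v∈ (inj₁ u∈A)          = within-anticomplete u∈A v∈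
      anticomplete u v v∈ (inj₂ (zero , refl)) =
        within-anticomplete (subst (_∈ Within j) (sym p₀≡z) (root∈within j)) v∈
      anticomplete u v v∈ (inj₂ (suc i , refl)) =
        tail-blind i (proj₁ (layer-∈ v∈)) (dist-suc-≢ (proj₂ (layer-∈ v∈)))

  DominatingSpire : ℕ → ℕ → Set
  DominatingSpire c d = Σ (Spire G d) λ s → Σ (Subset n) λ C → Dominates G s C × ¬ Colourable G C c

  record Tower (k m : ℕ) : Set where
    field
      path         : Fin (suc k) → Fin n
      reservoir    : Subset n
      induced      : IsInducedPath G k path
      avoids       : ∀ i → path i ∉ reservoir
      anticomplete : ∀ i w → w ∈ reservoir → ¬ Adj G (path (suc i)) w
      rooted       : ∀ w → w ∈ reservoir → ReachIn G (reservoir ∪ ⁅ path zero ⁆) (path zero) w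
      chromatic    : ¬ Colourable G reservoir m

  -- A graph of chromatic number > m + 2 has a tower of height 0 and weight m + 1:
  -- a vertex r and the rest of its component, which is not (m+1)-colourable.
  tower-start : ∀ {m} → ¬ Colourable G ⊤ (suc (suc m)) → Tower 0 (suc m)
  tower-start {m} χ> = from-component (bad-component χ>)
    where
    from-component : ∃[ r ] (r ∈ ⊤ × ¬ Colourable G (Comp ⊤ r) (suc (suc m))) → Tower 0 (suc m)
    from-component (r , _ , comp-chromatic) = record
      { path = λ _ → r ; reservoir = D ; induced = trivial-path r
      ; avoids = λ _ r∈D → proj₂ (select-∈ D? r∈D) refl
      ; anticomplete = λ ()
      ; rooted = λ w w∈D → reach-⊆ (λ v∈ → x∈p∪q⁺ (swap (x∈p∪q⁻ ⁅ r ⁆ D (split v∈))))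
                                  (comp-rooted (proj₁ (select-∈ D? w∈D)))
      ; chromatic = λ col → comp-chromatic (colourable-∪ split (subsingleton-colourable same) col) }
      where
      D? : Decidable (λ v → v ∈ Comp ⊤ r × v ≢ r)
      D? v = v ∈? Comp ⊤ r ×-dec ¬? (v Fin.≟ r)

      D : Subset n
      D = select D?

      split : Comp ⊤ r ⊆ ⁅ r ⁆ ∪ D
      split {v} v∈ with v Fin.≟ r
      ... | yes refl = x∈p∪q⁺ (inj₁ (x∈⁅x⁆ r))
      ... | no v≢r   = x∈p∪q⁺ (inj₂ (∈-select D? (v∈ , v≢r)))

      same : ∀ {u v} → u ∈ ⁅ r ⁆ → v ∈ ⁅ r ⁆ → u ≡ v
      same u∈ v∈ = trans (x∈⁅y⁆⇒x≡y r u∈) (sym (x∈⁅y⁆⇒x≡y r v∈))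

  tower-prepend : ∀ {k m m'} (T : Tower k m') {Y y x} →
    Y ⊆ Tower.reservoir T → (∀ {v} → v ∈ Y → ¬ Adj G (Tower.path T zero) v) →
    y ∈ Tower.reservoir T → y ∉ Y → Adj G y (Tower.path T zero) → Adj G y x →
    (∀ {v} → v ∈ Y → ReachIn G Y x v) → ¬ Colourable G Y m → Tower (suc k) m
  tower-prepend T {Y} {y} Y⊆D Y-unseen y∈D y∉Y y~p₀ y~x from-x Y-chromatic = record
    { path = y ∷ path ; reservoir = Y
    ; induced = prepend-induced induced (λ i y≡ → avoids i (subst (_∈ reservoir) y≡ y∈D)) y~p₀
                                (λ i y~ → anticomplete i y y∈D (adj-sym y~))
    ; avoids = avoids′ ; anticomplete = anticomplete′
    ; rooted = λ w w∈ → step (x∈p∪q⁺ (inj₂ (x∈⁅x⁆ y))) y~x (reach-⊆ (p⊆p∪q ⁅ y ⁆) (from-x w∈))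
    ; chromatic = Y-chromatic }
    where
    open Tower T

    avoids′ : ∀ i → (y ∷ path) i ∉ Y
    avoids′ zero    = y∉Y
    avoids′ (suc i) = avoids i ∘ Y⊆D

    anticomplete′ : ∀ i w → w ∈ Y → ¬ Adj G ((y ∷ path) (suc i)) w
    anticomplete′ zero    _ w∈ = Y-unseen w∈
    anticomplete′ (suc i) w w∈ = anticomplete i w (Y⊆D w∈)

  module _ {τ : ℕ} (χ¹≤τ : Chi1≤ G τ) where

    -- Drop from D the neighbours of p₀ (τ colours), take a
    -- component Y of the rest that needs more than m + 1 colours, and follow a
    -- walk from p₀ into Y: its last vertex y before Y is a neighbour of p₀ in D.
    tower-extend : ∀ {k m} → Tower k (suc m + τ) → Tower (suc k) (suc m)
    tower-extend {k} {m} T = from-component (bad-component X-chromatic)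
      where
      open Tower T

      X? : Decidable (λ v → v ∈ reservoir × ¬ Adj G (path zero) v)
      X? v = v ∈? reservoir ×-dec ¬? (adj? (path zero) v)

      X : Subset n
      X = select X?

      X-chromatic : ¬ Colourable G X (suc m)
      X-chromatic col = chromatic (colourable-∪ split col (nbr-colourable χ¹≤τ (path zero)))
        where
        split : reservoir ⊆ X ∪ nbr (path zero)
        split {v} v∈ with adj? (path zero) v
        ... | yes a  = x∈p∪q⁺ (inj₂ (∈-select (adj? (path zero)) a))
        ... | no ¬a  = x∈p∪q⁺ (inj₁ (∈-select X? (v∈ , ¬a)))

      from-component : ∃[ r ] (r ∈ X × ¬ Colourable G (Comp X r) (suc m)) → Tower (suc k) (suc m)
      from-component (r , r∈X , Y-chromatic) =
        from-exit (exit (rooted r (proj₁ (select-∈ X? r∈X))) p₀∉Y (root∈Ball r∈X n))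
        where
        Y⊆D : Comp X r ⊆ reservoir
        Y⊆D v∈ = proj₁ (select-∈ X? (comp-⊆ v∈))

        Y-unseen : ∀ {v} → v ∈ Comp X r → ¬ Adj G (path zero) v
        Y-unseen v∈ = proj₂ (select-∈ X? (comp-⊆ v∈))

        p₀∉Y : path zero ∉ Comp X r
        p₀∉Y p₀∈ = avoids zero (Y⊆D p₀∈)

        from-exit : ∃₂ (λ y x → y ∈ reservoir ∪ ⁅ path zero ⁆ × y ∉ Comp X r × x ∈ Comp X r × Adj G y x) →
                    Tower (suc k) (suc m)
        from-exit (y , x , y∈ , y∉Y , x∈Y , y~x) =
          tower-prepend T Y⊆D Y-unseen y∈D y∉Y (adj-sym p₀~y) y~x from-x Y-chromatic
          where
          -- y is not p₀, since p₀ sees nothing in Y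
          y∈D : y ∈ reservoir
          y∈D with x∈p∪q⁻ reservoir ⁅ path zero ⁆ y∈
          ... | inj₁ y∈D  = y∈D
          ... | inj₂ y∈p₀ = ⊥-elim (Y-unseen x∈Y (subst (λ w → Adj G w x) (x∈⁅y⁆⇒x≡y _ y∈p₀) y~x))

          -- otherwise y ∈ X would join the component Y of its neighbour x
          p₀~y : Adj G (path zero) y
          p₀~y with adj? (path zero) y
          ... | yes a  = a
          ... | no ¬a  = ⊥-elim (y∉Y (comp-closed x∈Y (∈-select X? (y∈D , ¬a)) (adj-sym y~x)))

          from-x : ∀ {v} → v ∈ Comp X r → ReachIn G (Comp X r) x v
          from-x v∈ = reach-++ (reach-reverse (comp-rooted x∈Y)) (comp-rooted v∈)

    -- d growth steps, each paying τ colours.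
    tower-climb : ∀ d {m} → Tower 0 (suc m + d * τ) → Tower d (suc m)
    tower-climb zero    {m} T = subst (Tower 0) (+-identityʳ (suc m)) T
    tower-climb (suc d) {m} T =
      tower-extend (tower-climb d {m + τ} (subst (Tower 0) (cong suc (sym (+-assoc m τ (d * τ)))) T))

    -- A tower of weight 2(1 + c ⊔ τ) yields the spire: lay out D ∪ {p₀} in
    -- breadth-first layers from p₀ and take a layer of chromatic number > c.
    tower-spire : ∀ c {d} → Tower d (suc (c ⊔ τ) + suc (c ⊔ τ)) → DominatingSpire c d
    tower-spire c {d} T =
      from-layer (bad-layer c (nbr-colourable χ¹≤τ (path zero)) (chromatic ∘ colourable-⊆ (p⊆p∪q _)))
      where
      open Tower T

      S : Subset n
      S = reservoir ∪ ⁅ path zero ⁆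

      p₀∈S : path zero ∈ S
      p₀∈S = x∈p∪q⁺ (inj₂ (x∈⁅x⁆ (path zero)))

      spans : S ⊆ Comp S (path zero)
      spans v∈ with x∈p∪q⁻ reservoir ⁅ path zero ⁆ v∈
      ... | inj₁ v∈D  = reach-comp (rooted _ v∈D)
      ... | inj₂ v∈p₀ = subst (_∈ Comp S (path zero)) (sym (x∈⁅y⁆⇒x≡y _ v∈p₀)) (root∈Ball p₀∈S n)

      open Layers S (path zero) p₀∈S spans

      tail-outside : ∀ i → path (suc i) ∉ S
      tail-outside i p∈ with x∈p∪q⁻ reservoir ⁅ path zero ⁆ p∈
      ... | inj₁ p∈D  = avoids (suc i) p∈D
      ... | inj₂ p∈p₀ with proj₁ induced (x∈⁅y⁆⇒x≡y _ p∈p₀)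
      ...   | ()

      tail-blind : ∀ i {v} → v ∈ S → v ≢ path zero → ¬ Adj G (path (suc i)) v
      tail-blind i {v} v∈ v≢p₀ with x∈p∪q⁻ reservoir ⁅ path zero ⁆ v∈
      ... | inj₁ v∈D  = anticomplete i v v∈D
      ... | inj₂ v∈p₀ = ⊥-elim (v≢p₀ (x∈⁅y⁆⇒x≡y _ v∈p₀))

      from-layer : ∃[ j ] ¬ Colourable G (Layer (2 + j)) c → DominatingSpire c d
      from-layer (j , ¬col) with layer-spire path induced refl tail-outside tail-blind j
      ... | spire , dominates = spire , Layer (2 + j) , dominates , ¬col

-- With c' = 2 + m + dτ, where m + 1 = 2(1 + c ⊔ τ): a tower of weight m + 1 + dτ
-- exists, d growth steps lower its weight to m + 1, and its layers give the spire.
mainTheorem15 : (c d τ : ℕ) → ∃[ c' ] (∀ (n : ℕ) (G : Graph n) →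
    Chi1≤ G τ → ¬ Chi≤ G c' →
    Σ (Spire G d) λ s → Σ (Subset n) λ C →
    Dominates G s C × ¬ Colourable G C c)
mainTheorem15 c d τ = suc (suc (m + d * τ)) , λ n G χ¹≤τ χ>c' →
  tower-spire G χ¹≤τ c (tower-climb G χ¹≤τ d (tower-start G (χ>c' ∘ chromatic-bound G)))
  where
  m : ℕ
  m = c ⊔ τ + suc (c ⊔ τ)
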